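{- Let $p\ge5$ be a prime split in an imaginary quadratic field $K$, and $f\in S_2(\Gamma_0(N))$ a newform with $p\nmid N$, $N=N^+N^-$, $N^-$ square-free and a product of an odd number of primes, and $a_p(f)\equiv0\pmod\varpi$. Then for all $n\ge1$, $$\mathcal{L}_{f,n}\equiv\begin{cases}(-1)^{n/2}\,\omega_n^-\,\mathcal{L}_f^\sharp \pmod{(\omega_n,\varpi)} & n\text{ even},\\ (-1)^{(n-1)/2}\,\omega_n^+\,\mathcal{L}_f^\flat\pmod{(\omega_n,\varpi)} & n\text{ odd}.\end{cases}$$
   Context: $K_\infty$ is the anticyclotomic $\mathbb{Z}_p$-extension of $K$, $K_n$ its subextension of degree $p^n$ over $K$, $G_n=\mathrm{Gal}(K_n/K)$, $\gamma$ a topological generator of $\mathrm{Gal}(K_\infty/K)$; primes dividing $N^+$ split in $K$, those dividing $N^-$ inert. $\mathcal{O}$ is the ring of integers of the completion at a prime above $p$ of the coefficient field of $f$, uniformizer $\varpi$; $\Lambda=\varprojlim\mathcal{O}[G_n]$, and $\mathcal{O}[G_n]\cong\Lambda/(\omega_n)$. $\omega_n=\gamma^{p^n}-1$, $\Phi_n=\omega_n/\omega_{n-1}$ ($n\ge1$), $\omega_n^+=\prod_{1\le j\le n,\,j\text{ even}}\Phi_j$, $\omega_n^-=\prod_{1\le j\le n,\,j\text{ odd}}\Phi_j$. $\mathcal{L}_{f,n}\in\mathcal{O}[G_n]$ are the Bertolini–Darmon theta elements of $f$ (built from the Jacquet–Langlands transfer $h$ of $f$ to the definite quaternion algebra of discriminant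 $N^-$ as $\sum_{\sigma}h(\sigma\star v_n)\sigma^{ -1}$, projected to $\mathcal{O}[G_n]$), satisfying $\pi_n^{n+1}(\mathcal{L}_{f,n+1})=a_p(f)\mathcal{L}_{f,n}-\xi_{n-1}(\mathcal{L}_{f,n-1})$ with $\xi_{n-1}:\mathcal{O}[G_{n-1}]\to\mathcal{O}[G_n]$ the norm map. With $C_{f,n}=\begin{pmatrix}a_p(f)&1\\-\Phi_n&0\end{pmatrix}$ and $H_{f,n}=C_{f,n}\cdots C_{f,1}$, $\mathcal{L}_f^\sharp,\mathcal{L}_f^\flat\in\Lambda$ are the unique elements with $H_{f,n}\binom{\mathcal{L}_f^\sharp}{\mathcal{L}_f^\flat}\equiv\binom{\mathcal{L}_{f,n}}{ -\xi_{n-1}\mathcal{L}_{f,n-1}}\pmod{\omega_n}$ for all $n\ge1$. -}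

module Defs where

import Level
open import Algebra.Bundles using (CommutativeRing)
open import Data.Nat as ℕ using (ℕ; zero; suc; ⌊_/2⌋)
open import Data.Bool using (Bool; true; false; not)
open import Data.Product using (Σ; ∃; _×_; _,_)

isEven : ℕ → Bool
isEven zero = true
isEven (suc n) = not (isEven n)

-- Everything below lives in an abstract commutative ring R playing the role of
-- the Iwasawa algebra Λ; elements of O[G_n] = Λ/(ω_n) are represented by lifts to Λ.
module Iw {c ℓ} (R : CommutativeRing c ℓ) where
  open CommutativeRing R

  pow : Carrier → ℕ → Carrier
  pow x zero = 1#
  pow x (suc n) = x * pow x n

  ω : (p : ℕ) (γ : Carrier) → ℕ → Carrier
  ω p γ n = pow γ (p ℕ.^ n) - 1#

  geom : Carrier → ℕ → Carrier
  geom x zero = 0#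
  geom x (suc m) = 1# + x * geom x m

  -- Φ_n = ω_n / ω_(n-1) = 1 + y + ... + y^(p-1), y = γ^(p^(n-1))  (n ≥ 1)
  Φ : (p : ℕ) (γ : Carrier) → ℕ → Carrier
  Φ p γ n = geom (pow γ (p ℕ.^ (n ℕ.∸ 1))) p

  ωplus : (p : ℕ) (γ : Carrier) → ℕ → Carrier
  ωplus p γ zero = 1#
  ωplus p γ (suc n) with isEven (suc n)
  ... | true  = Φ p γ (suc n) * ωplus p γ n
  ... | false = ωplus p γ n

  ωminus : (p : ℕ) (γ : Carrier) → ℕ → Carrier
  ωminus p γ zero = 1#
  ωminus p γ (suc n) with isEven (suc n)
  ... | true  = ωminus p γ n
  ... | false = Φ p γ (suc n) * ωminus p γ n

  record Mat : Set c where
    constructor mat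
    field a11 a12 a21 a22 : Carrier
  open Mat public

  _⊗_ : Mat → Mat → Mat
  mat a b c' d ⊗ mat e f g h = mat (a * e + b * g) (a * f + b * h) (c' * e + d * g) (c' * f + d * h)

  Cmat : (p : ℕ) (γ ap : Carrier) → ℕ → Mat
  Cmat p γ ap n = mat ap 1# (- Φ p γ n) 0#

  Hmat : (p : ℕ) (γ ap : Carrier) → ℕ → Mat
  Hmat p γ ap zero = mat 1# 0# 0# 1#
  Hmat p γ ap (suc n) = Cmat p γ ap (suc n) ⊗ Hmat p γ ap n

  row1 : Mat → Carrier → Carrier → Carrier
  row1 M x y = a11 M * x + a12 M * y
  row2 : Mat → Carrier → Carrier → Carrier
  row2 M x y = a21 M * x + a22 M * y

  _≡_mod₁_ : Carrier → Carrier → Carrier → Set (c Level.⊔ ℓ)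
  x ≡ y mod₁ a = ∃ λ t → x ≈ y + a * t

  _≡_mod₂_,_ : Carrier → Carrier → Carrier → Carrier → Set (c Level.⊔ ℓ)
  x ≡ y mod₂ a , b = ∃ λ s → ∃ λ t → x ≈ y + (a * s + b * t)

  -- (-1)^⌊n/2⌋  (= (-1)^(n/2) for n even, (-1)^((n-1)/2) for n odd)
  sgn : ℕ → Carrier
  sgn n = pow (- 1#) ⌊ n /2⌋

{-# OPTIONS --safe #-}
-- Reducing modulo ϖ kills a_p, and with a_p = 0 each C_k = [[0, 1], [-Φ_k, 0]]
-- swaps the two rows and multiplies the new bottom row by -Φ_k. Hence H_{f,n}
-- is, modulo ϖ, diagonal with entries ±ω⁻_n, ±ω⁺_n for n even and
-- antidiagonal for n odd, and the first row of the defining congruence of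
-- L♯, L♭ modulo ω_n gives the claim.
module Submission where

open import Defs
open import Algebra.Bundles using (CommutativeRing)
open import Algebra.Definitions using (Congruent₂)
open import Data.Bool using (T; not; true; false)
open import Data.Bool.Properties using (not-involutive)
open import Data.Maybe using (nothing)
open import Data.Nat using (ℕ; zero; suc; _≤_; _∸_; ⌊_/2⌋)
open import Data.Nat.Primality using (Prime)
open import Data.Product using (∃; _×_; _,_; proj₁)
open import Relation.Binary.Core using (Rel)
open import Relation.Binary.Definitions using (Reflexive)
open import Relation.Binary.PropositionalEquality as ≡ using (_≡_)

T-not-not : ∀ {b} → T (not (not b)) → T b
T-not-not {b} = ≡.subst T (not-involutive b)

even⇒⌊1+n/2⌋≡⌊n/2⌋ : ∀ n → T (isEven n) → ⌊ suc n /2⌋ ≡ ⌊ n /2⌋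
odd⇒⌊1+n/2⌋≡1+⌊n/2⌋ : ∀ n → T (not (isEven n)) → ⌊ suc n /2⌋ ≡ suc ⌊ n /2⌋
even⇒⌊1+n/2⌋≡⌊n/2⌋ zero    _ = ≡.refl
even⇒⌊1+n/2⌋≡⌊n/2⌋ (suc n) e = ≡.sym (odd⇒⌊1+n/2⌋≡1+⌊n/2⌋ n e)
odd⇒⌊1+n/2⌋≡1+⌊n/2⌋ zero    ()
odd⇒⌊1+n/2⌋≡1+⌊n/2⌋ (suc n) o = ≡.cong suc (≡.sym (even⇒⌊1+n/2⌋≡⌊n/2⌋ n (T-not-not o)))

module Properties {c ℓ} (R : CommutativeRing c ℓ) where
  open CommutativeRing R
  open Iw R
  open import Algebra.Properties.Ring ring using (-1*x≈-x; -‿distribˡ-*; -‿distribʳ-*)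
  open import Algebra.Properties.Group +-group using (//-rightDividesʳ)
  open import Algebra.Solver.Ring.NaturalCoefficients commutativeSemiring (λ _ _ → nothing)
    using (solve; _:=_; _:+_; _:*_)
  open import Relation.Binary.Reasoning.Setoid setoid

  -x*[y*z]≈[-1*y]*[x*z] : ∀ F S W → - F * (S * W) ≈ (- 1# * S) * (F * W)
  -x*[y*z]≈[-1*y]*[x*z] F S W = begin
    - F * (S * W)         ≈⟨ -‿distribˡ-* F (S * W) ⟨
    - (F * (S * W))       ≈⟨ -‿cong (solve 3 (λ F S W → F :* (S :* W) := S :* (F :* W)) refl F S W) ⟩
    - (S * (F * W))       ≈⟨ -‿distribˡ-* S (F * W) ⟩
    - S * (F * W)         ≈⟨ *-congʳ (-1*x≈-x S) ⟨
    (- 1# * S) * (F * W)  ∎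

  module _ (a : Carrier) where
    mod₁-refl : Reflexive (_≡_mod₁ a)
    mod₁-refl {x} = 0# , (begin
      x           ≈⟨ +-identityʳ x ⟨
      x + 0#      ≈⟨ +-congˡ (zeroʳ a) ⟨
      x + a * 0#  ∎)

    mod₁-+-cong : Congruent₂ (_≡_mod₁ a) _+_
    mod₁-+-cong {x} {x'} {y} {y'} (s , x≈) (t , y≈) = s + t , (begin
      x + y                        ≈⟨ +-cong x≈ y≈ ⟩
      (x' + a * s) + (y' + a * t)  ≈⟨ solve 5 (λ x y a s t → (x :+ a :* s) :+ (y :+ a :* t) := (x :+ y) :+ a :* (s :+ t)) refl x' y' a s t ⟩
      (x' + y') + a * (s + t)      ∎)

    mod₁-*-cong : Congruent₂ (_≡_mod₁ a) _*_
    mod₁-*-cong {x} {x'} {y} {y'} (s , x≈) (t , y≈) = s * y' + x' * t + a * (s * t) , (begin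
      x * y                                          ≈⟨ *-cong x≈ y≈ ⟩
      (x' + a * s) * (y' + a * t)                    ≈⟨ solve 5 (λ x y a s t → (x :+ a :* s) :* (y :+ a :* t) := x :* y :+ a :* (s :* y :+ x :* t :+ a :* (s :* t))) refl x' y' a s t ⟩
      x' * y' + a * (s * y' + x' * t + a * (s * t))  ∎)

    mod₁-respʳ : ∀ {x y z} → y ≈ z → x ≡ y mod₁ a → x ≡ z mod₁ a
    mod₁-respʳ y≈z (s , x≈) = s , trans x≈ (+-congʳ y≈z)

  mod₁-join : ∀ {a b r x y} → r ≡ x mod₁ a → r ≡ y mod₁ b → x ≡ y mod₂ a , b
  mod₁-join {a} {b} {r} {x} {y} (t , r≈x) (s , r≈y) = - t , s , (begin
    x                          ≈⟨ //-rightDividesʳ (a * t) x ⟨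
    (x + a * t) + - (a * t)    ≈⟨ +-cong (trans (sym r≈x) r≈y) (-‿distribʳ-* a t) ⟩
    (y + b * s) + a * - t      ≈⟨ +-assoc y (b * s) (a * - t) ⟩
    y + (b * s + a * - t)      ≈⟨ +-congˡ (+-comm (b * s) (a * - t)) ⟩
    y + (a * - t + b * s)      ∎)

  Entrywise : ∀ {r} → Rel Carrier r → Rel Mat r
  Entrywise _∼_ M N = (a11 M ∼ a11 N) × (a12 M ∼ a12 N) × (a21 M ∼ a21 N) × (a22 M ∼ a22 N)

  module EntrywiseCongruence {r} (_∼_ : Rel Carrier r) (∼-refl : Reflexive _∼_)
    (+-cong∼ : Congruent₂ _∼_ _+_) (*-cong∼ : Congruent₂ _∼_ _*_) where

    ⊗-cong : ∀ {M M' N N'} → Entrywise _∼_ M M' → Entrywise _∼_ N N' → Entrywise _∼_ (M ⊗ N) (M' ⊗ N')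
    ⊗-cong (a , b , c , d) (e , f , g , h) =
      +-cong∼ (*-cong∼ a e) (*-cong∼ b g) , +-cong∼ (*-cong∼ a f) (*-cong∼ b h) ,
      +-cong∼ (*-cong∼ c e) (*-cong∼ d g) , +-cong∼ (*-cong∼ c f) (*-cong∼ d h)

    Hmat-cong : ∀ p γ {ap ap'} → ap ∼ ap' → ∀ n → Entrywise _∼_ (Hmat p γ ap n) (Hmat p γ ap' n)
    Hmat-cong p γ ap∼ zero    = ∼-refl , ∼-refl , ∼-refl , ∼-refl
    Hmat-cong p γ ap∼ (suc n) = ⊗-cong (ap∼ , ∼-refl , ∼-refl , ∼-refl) (Hmat-cong p γ ap∼ n)

    row1-cong : ∀ {M N} x y → Entrywise _∼_ M N → row1 M x y ∼ row1 N x y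
    row1-cong x y (a , b , _) = +-cong∼ (*-cong∼ a ∼-refl) (*-cong∼ b ∼-refl)

  infix 4 _≋_
  _≋_ : Rel Mat ℓ
  _≋_ = Entrywise _≈_

  ≋-trans : ∀ {M N P} → M ≋ N → N ≋ P → M ≋ P
  ≋-trans (a , b , c , d) (a' , b' , c' , d') = trans a a' , trans b b' , trans c c' , trans d d'

  open EntrywiseCongruence _≈_ refl +-cong *-cong using (row1-cong)

  sgn-suc-even : ∀ n → T (isEven n) → sgn (suc n) ≡ sgn n
  sgn-suc-even n e = ≡.cong (pow (- 1#)) (even⇒⌊1+n/2⌋≡⌊n/2⌋ n e)

  sgn-suc-odd : ∀ n → T (not (isEven n)) → sgn (suc n) ≡ - 1# * sgn n
  sgn-suc-odd n o = ≡.cong (pow (- 1#)) (odd⇒⌊1+n/2⌋≡1+⌊n/2⌋ n o)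

  module _ (p : ℕ) (γ : Carrier) where
    ωplus-suc-even : ∀ n → T (isEven n) → ωplus p γ (suc n) ≡ ωplus p γ n
    ωplus-suc-even n e with isEven n
    ... | true = ≡.refl

    ωplus-suc-odd : ∀ n → T (not (isEven n)) → ωplus p γ (suc n) ≡ Φ p γ (suc n) * ωplus p γ n
    ωplus-suc-odd n o with isEven n
    ... | false = ≡.refl

    ωminus-suc-even : ∀ n → T (isEven n) → ωminus p γ (suc n) ≡ Φ p γ (suc n) * ωminus p γ n
    ωminus-suc-even n e with isEven n
    ... | true = ≡.refl

    ωminus-suc-odd : ∀ n → T (not (isEven n)) → ωminus p γ (suc n) ≡ ωminus p γ n
    ωminus-suc-odd n o with isEven n
    ... | false = ≡.refl

    Cmat-zero-⊗ : ∀ k M →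
      Cmat p γ 0# k ⊗ M ≋ mat (a21 M) (a22 M) (- Φ p γ k * a11 M) (- Φ p γ k * a12 M)
    Cmat-zero-⊗ k M = upper , upper , lower , lower
      where
      upper : ∀ {x y} → 0# * x + 1# * y ≈ y
      upper {x} {y} = trans (+-cong (zeroˡ x) (*-identityˡ y)) (+-identityˡ y)
      lower : ∀ {x y} → - Φ p γ k * x + 0# * y ≈ - Φ p γ k * x
      lower {x} {y} = trans (+-congˡ (zeroˡ y)) (+-identityʳ _)

    Hmat-zero-suc-even : ∀ n → T (isEven n) →
      Hmat p γ 0# n ≋ mat (sgn n * ωminus p γ n) 0# 0# (sgn n * ωplus p γ n) →
      Hmat p γ 0# (suc n) ≋ mat 0# (sgn (suc n) * ωplus p γ (suc n)) (sgn (suc (suc n)) * ωminus p γ (suc n)) 0#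
    Hmat-zero-suc-even n e (H₁₁ , H₁₂ , H₂₁ , H₂₂) = ≋-trans (Cmat-zero-⊗ (suc n) (Hmat p γ 0# n))
      ( H₂₁
      , trans H₂₂ (reflexive (≡.cong₂ _*_ (≡.sym (sgn-suc-even n e)) (≡.sym (ωplus-suc-even n e))))
      , (begin
          - Φ p γ (suc n) * a11 (Hmat p γ 0# n)            ≈⟨ *-congˡ H₁₁ ⟩
          - Φ p γ (suc n) * (sgn n * ωminus p γ n)         ≈⟨ -x*[y*z]≈[-1*y]*[x*z] _ _ _ ⟩
          (- 1# * sgn n) * (Φ p γ (suc n) * ωminus p γ n)  ≡⟨ ≡.cong (sgn (suc (suc n)) *_) (≡.sym (ωminus-suc-even n e)) ⟩
          sgn (suc (suc n)) * ωminus p γ (suc n)           ∎)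
      , trans (*-congˡ H₁₂) (zeroʳ _))

    Hmat-zero-suc-odd : ∀ n → T (not (isEven n)) →
      Hmat p γ 0# n ≋ mat 0# (sgn n * ωplus p γ n) (sgn (suc n) * ωminus p γ n) 0# →
      Hmat p γ 0# (suc n) ≋ mat (sgn (suc n) * ωminus p γ (suc n)) 0# 0# (sgn (suc n) * ωplus p γ (suc n))
    Hmat-zero-suc-odd n o (H₁₁ , H₁₂ , H₂₁ , H₂₂) = ≋-trans (Cmat-zero-⊗ (suc n) (Hmat p γ 0# n))
      ( trans H₂₁ (reflexive (≡.cong (sgn (suc n) *_) (≡.sym (ωminus-suc-odd n o))))
      , H₂₂
      , trans (*-congˡ H₁₁) (zeroʳ _)
      , (begin
          - Φ p γ (suc n) * a12 (Hmat p γ 0# n)           ≈⟨ *-congˡ H₁₂ ⟩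
          - Φ p γ (suc n) * (sgn n * ωplus p γ n)         ≈⟨ -x*[y*z]≈[-1*y]*[x*z] _ _ _ ⟩
          (- 1# * sgn n) * (Φ p γ (suc n) * ωplus p γ n)  ≡⟨ ≡.cong₂ _*_ (≡.sym (sgn-suc-odd n o)) (≡.sym (ωplus-suc-odd n o)) ⟩
          sgn (suc n) * ωplus p γ (suc n)                 ∎))

    Hmat-zero-even : ∀ n → T (isEven n) →
      Hmat p γ 0# n ≋ mat (sgn n * ωminus p γ n) 0# 0# (sgn n * ωplus p γ n)
    Hmat-zero-odd : ∀ n → T (not (isEven n)) →
      Hmat p γ 0# n ≋ mat 0# (sgn n * ωplus p γ n) (sgn (suc n) * ωminus p γ n) 0#
    Hmat-zero-even zero    _ = sym (*-identityˡ 1#) , refl , refl , sym (*-identityˡ 1#)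
    Hmat-zero-even (suc n) o = Hmat-zero-suc-odd n o (Hmat-zero-odd n o)
    Hmat-zero-odd  zero    ()
    Hmat-zero-odd  (suc n) o = Hmat-zero-suc-even n (T-not-not o) (Hmat-zero-even n (T-not-not o))

    row1-Hmat-zero-even : ∀ n x y → T (isEven n) → row1 (Hmat p γ 0# n) x y ≈ sgn n * (ωminus p γ n * x)
    row1-Hmat-zero-even n x y e = begin
      row1 (Hmat p γ 0# n) x y                 ≈⟨ row1-cong x y (Hmat-zero-even n e) ⟩
      (sgn n * ωminus p γ n) * x + 0# * y      ≈⟨ +-congˡ (zeroˡ y) ⟩
      (sgn n * ωminus p γ n) * x + 0#          ≈⟨ +-identityʳ _ ⟩
      (sgn n * ωminus p γ n) * x               ≈⟨ *-assoc _ _ _ ⟩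
      sgn n * (ωminus p γ n * x)               ∎

    row1-Hmat-zero-odd : ∀ n x y → T (not (isEven n)) → row1 (Hmat p γ 0# n) x y ≈ sgn n * (ωplus p γ n * y)
    row1-Hmat-zero-odd n x y o = begin
      row1 (Hmat p γ 0# n) x y                 ≈⟨ row1-cong x y (Hmat-zero-odd n o) ⟩
      0# * x + (sgn n * ωplus p γ n) * y       ≈⟨ +-congʳ (zeroˡ x) ⟩
      0# + (sgn n * ωplus p γ n) * y           ≈⟨ +-identityˡ _ ⟩
      (sgn n * ωplus p γ n) * y                ≈⟨ *-assoc _ _ _ ⟩
      sgn n * (ωplus p γ n * y)                ∎

lemma5p5 : ∀ {c ℓ} (R : CommutativeRing c ℓ) →
    let open CommutativeRing R
        open Iw R
    in (p : ℕ) → Prime p → 5 ≤ p →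
       (γ ϖ ap L♯ L♭ : Carrier) (L : ℕ → Carrier) →
       -- a_p(f) ≡ 0 mod ϖ
       (∃ λ t → ap ≈ ϖ * t) →
       -- π(L_{n+1}) = a_p L_n - ξ_{n-1}(L_{n-1}) in O[G_n], ξ_{n-1} = multiplication by Φ_n
       (∀ n → 1 ≤ n → L (suc n) ≡ ap * L n - Φ p γ n * L (n ∸ 1) mod₁ ω p γ n) →
       -- defining property of L♯, L♭
       (∀ n → 1 ≤ n →
          (row1 (Hmat p γ ap n) L♯ L♭ ≡ L n mod₁ ω p γ n) ×
          (row2 (Hmat p γ ap n) L♯ L♭ ≡ - (Φ p γ n * L (n ∸ 1)) mod₁ ω p γ n)) →
       ∀ n → 1 ≤ n →
         (T (isEven n) → L n ≡ sgn n * (ωminus p γ n * L♯) mod₂ ω p γ n , ϖ) ×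
         (T (not (isEven n)) → L n ≡ sgn n * (ωplus p γ n * L♭) mod₂ ω p γ n , ϖ)
lemma5p5 R p _ _ γ ϖ ap L♯ L♭ L (t , ap≈ϖt) _ L♯L♭-spec n n≥1 =
  (λ e → mod₁-join row1≡L (mod₁-respʳ ϖ (row1-Hmat-zero-even p γ n L♯ L♭ e) row1≡row1₀)) ,
  (λ o → mod₁-join row1≡L (mod₁-respʳ ϖ (row1-Hmat-zero-odd p γ n L♯ L♭ o) row1≡row1₀))
  where
  open CommutativeRing R
  open Iw R
  open Properties R
  open EntrywiseCongruence (_≡_mod₁ ϖ) (mod₁-refl ϖ) (mod₁-+-cong ϖ) (mod₁-*-cong ϖ) using (Hmat-cong; row1-cong)

  row1≡L : row1 (Hmat p γ ap n) L♯ L♭ ≡ L n mod₁ ω p γ n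
  row1≡L = proj₁ (L♯L♭-spec n n≥1)

  row1≡row1₀ : row1 (Hmat p γ ap n) L♯ L♭ ≡ row1 (Hmat p γ 0# n) L♯ L♭ mod₁ ϖ
  row1≡row1₀ = row1-cong L♯ L♭ (Hmat-cong p γ ap≡0 n)
    where
    ap≡0 : ap ≡ 0# mod₁ ϖ
    ap≡0 = t , trans ap≈ϖt (sym (+-identityˡ _))
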